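{- Let $L$, $M$, $N$ be finite sets and let $\delta:L^{(2)}\to M$ and $\varepsilon:L^{(2)}\to 2^N$. Then $(\delta,\varepsilon)$ is tree-like if and only if (1) $\delta$ is a symbolic ultrametric, (2) $\varepsilon$ is a Fitch map, and (3) $\mathcal{H}^*:=\mathcal{H}(T_\delta)\cup\mathcal{H}(T_\varepsilon)$ is a hierarchy on $L$. In this case there is a unique least-resolved vertex- and edge-labeled tree $(T^*,t^*,\lambda^*)$ explaining $(\delta,\varepsilon)$: the tree $T^*$ is the tree with $\mathcal{H}(T^*)=\mathcal{H}^*$, the vertex labeling $t^*$ is uniquely determined by $t_\delta$, and the edge labeling $\lambda^*$ minimizing $\sum_{e\in E(T^*)}|\lambda^*(e)|$ is uniquely determined by $\lambda_\varepsilon$.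
   Context: $L^{(2)}=\{(x,y)\mid x,y\in L,\ x\ne y\}$. Trees are rooted phylogenetic (every inner vertex has $\ge2$ children) with leaf set $L$; $V^0(T)$ is the set of inner vertices, $L(T(u))$ the leaves below $u$, $\mathcal{H}(T)=\{L(T(u))\mid u\in V(T)\}$. A hierarchy on $L$ is $\mathcal{H}\subseteq 2^L$ with $L\in\mathcal{H}$, $\{x\}\in\mathcal{H}$ for all $x\in L$, and $A\cap B\in\{A,B,\emptyset\}$ for all $A,B\in\mathcal{H}$; hierarchies correspond bijectively to phylogenetic trees. $(T,t)$ with $t:V^0(T)\to M$ explains $\delta$ if $t(\operatorname{lca}_T(x,y))=\delta(x,y)$ for all $(x,y)\in L^{(2)}$. $(T,\lambda)$ with $\lambda:E(T)\to 2^N$ explains $\varepsilon$ if $k\in\varepsilon(x,y)$ iff $k\in\lambda(e)$ for some edge $e$ on the path from $\operatorname{lca}_T(x,y)$ to $y$. $(\delta,\varepsilon)$ is tree-like if there is a tree $T$ with $t:V^0(T)\to M$ and $\lambda:E(T)\to 2^N$ such that $(T,t)$ explains $\delta$ and $(T,\lambda)$ explains $\varepsilon$. A symbolic ultrametric is a map $\delta$ such that for all pairwise distinct $u,v,x,y\in L$: $\delta(x,y)=\delta(y,x)$; $\delta(x,y)=\delta(y,u)=\delta(u,v)\ne\delta(y,v)=\delta(x,v)=\delta(x,u)$ never holds; $|\{\delta(u,v),\delta(u,x),\delta(v,x)\}|\le2$. Such $\delta$ has a unique explaining tree $(T_\delta,t_\delta)$ whose labeling is discriminating ($t_\delta$ differs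 at the ends of every inner edge). A Fitch map is an $\varepsilon$ explained by some edge-labeled tree; its least-resolved tree $(T_\varepsilon,\lambda_\varepsilon)$ has $\mathcal{H}(T_\varepsilon)=\mathcal{N}_\varepsilon\cup\{L\}\cup\{\{x\}\mid x\in L\}$, where $\mathcal{N}_\varepsilon=\{U_{\neg m}[y]\mid y\in L,m\in N\}$, $U_{\neg m}[y]=\{x\ne y\mid m\notin\varepsilon(x,y)\}\cup\{y\}$, and $\lambda_\varepsilon(\{\operatorname{parent}(v),v\})=\{m\mid\exists y: L(T_\varepsilon(v))=U_{\neg m}[y]\}$. A labeled tree $(T,t,\lambda)$ explaining $(\delta,\varepsilon)$ is least-resolved if for no edge $e$ the contracted tree $T/e$ admits labelings $t',\lambda'$ such that $(T/e,t',\lambda')$ explains $(\delta,\varepsilon)$. -}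

module Defs where

open import Data.Nat using (ℕ; zero; suc; _+_; _≤_)
open import Data.Bool using (Bool; true; false; _∧_; _∨_; not; if_then_else_)
open import Data.Fin using (Fin; _≟_)
open import Data.Fin.Subset using (Subset; _∈_; _⊆_; ⁅_⁆; ⊤; ⊥; _∩_; ∣_∣)
open import Data.Vec using (Vec; []; _∷_; tabulate; lookup)
open import Data.List using (List; []; _∷_; map; _++_; allFin; concatMap)
open import Data.Bool.ListAction using (any)
open import Data.Nat.ListAction using (sum)
open import Data.Product using (Σ; _×_; _,_; ∃; Σ-syntax; ∃-syntax)
open import Data.Sum using (_⊎_)
open import Relation.Binary.PropositionalEquality using (_≡_; _≢_)
open import Relation.Nullary using (¬_)
open import Relation.Nullary.Decidable using (⌊_⌋)
open import Function.Bundles using (_⇔_)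

_≡ᵇ_ : ∀ {n} → Subset n → Subset n → Bool
[] ≡ᵇ [] = true
(a ∷ as) ≡ᵇ (b ∷ bs) = ((a ∧ b) ∨ (not a ∧ not b)) ∧ (as ≡ᵇ bs)

_⊆ᵇ_ : ∀ {n} → Subset n → Subset n → Bool
[] ⊆ᵇ [] = true
(a ∷ as) ⊆ᵇ (b ∷ bs) = (not a ∨ b) ∧ (as ⊆ᵇ bs)

_⊂ᵇ_ : ∀ {n} → Subset n → Subset n → Bool
A ⊂ᵇ B = (A ⊆ᵇ B) ∧ not (A ≡ᵇ B)

allSubsets : ∀ n → List (Subset n)
allSubsets zero = [] ∷ []
allSubsets (suc n) = map (true ∷_) (allSubsets n) ++ map (false ∷_) (allSubsets n)

-- Trees are represented by their hierarchies (set of clusters),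
-- given as a characteristic function on subsets of the leaf set Fin n.

Clusters : ℕ → Set
Clusters n = Subset n → Bool

IsHierarchy : ∀ {n} → Clusters n → Set
IsHierarchy {n} H =
  (H ⊤ ≡ true)
  × (∀ (x : Fin n) → H ⁅ x ⁆ ≡ true)
  × (∀ A B → H A ≡ true → H B ≡ true →
       (A ∩ B ≡ A) ⊎ (A ∩ B ≡ B) ⊎ (A ∩ B ≡ ⊥))

IsTree : ∀ {n} → Clusters n → Set
IsTree H = IsHierarchy H × (H ⊥ ≡ false)

-- edges (parent cluster A, child cluster B): Hasse diagram of ⊂ on clusters
isEdge : ∀ {n} → Clusters n → Subset n → Subset n → Bool
isEdge {n} T A B =
  T A ∧ T B ∧ (B ⊂ᵇ A) ∧
  not (any (λ C → T C ∧ (B ⊂ᵇ C) ∧ (C ⊂ᵇ A)) (allSubsets n))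

Edge : ∀ {n} → Clusters n → Subset n → Subset n → Set
Edge T A B = isEdge T A B ≡ true

Inner : ∀ {n} → Clusters n → Subset n → Set
Inner T A = (T A ≡ true) × (2 ≤ ∣ A ∣)

IsLca : ∀ {n} → Clusters n → Fin n → Fin n → Subset n → Set
IsLca T x y C =
  (T C ≡ true) × (x ∈ C) × (y ∈ C) ×
  (∀ B → T B ≡ true → x ∈ B → y ∈ B → C ⊆ B)

-- contraction of the edge above the (inner) cluster B
contract : ∀ {n} → Clusters n → Subset n → Clusters n
contract T B A = T A ∧ not (A ≡ᵇ B)

-- Explaining δ and ε.  Vertex labels t are given on all subsets but
-- only their values on inner vertices matter; edge labels λ A B are
-- only relevant for edges (A,B).

ExplainsV : ∀ {n m} → Clusters n → (Subset n → Fin m) → (Fin n → Fin n → Fin m) → Set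
ExplainsV T t δ = ∀ x y → x ≢ y → ∀ C → IsLca T x y C → t C ≡ δ x y

ExplainsE : ∀ {n k} → Clusters n → (Subset n → Subset n → Subset k) →
            (Fin n → Fin n → Subset k) → Set
ExplainsE {n} {k} T lam ε = ∀ x y → x ≢ y → ∀ C → IsLca T x y C → ∀ (j : Fin k) →
  (j ∈ ε x y) ⇔ (∃[ A ] ∃[ B ] (Edge T A B × y ∈ B × A ⊆ C × j ∈ lam A B))

Explains : ∀ {n m k} → Clusters n → (Fin n → Fin n → Fin m) → (Fin n → Fin n → Subset k) → Set
Explains {n} {m} {k} T δ ε = Σ[ t ∈ (Subset n → Fin m) ] Σ[ lam ∈ (Subset n → Subset n → Subset k) ]
  (ExplainsV T t δ × ExplainsE T lam ε)

TreeLike : ∀ {n m k} → (Fin n → Fin n → Fin m) → (Fin n → Fin n → Subset k) → Set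
TreeLike {n} δ ε = Σ[ T ∈ Clusters n ] (IsTree T × Explains T δ ε)

LeastResolved : ∀ {n m k} → Clusters n → (Fin n → Fin n → Fin m) → (Fin n → Fin n → Subset k) → Set
LeastResolved T δ ε = Explains T δ ε ×
  (∀ A B → Edge T A B → 2 ≤ ∣ B ∣ → ¬ Explains (contract T B) δ ε)

SymbolicUltrametric : ∀ {n m} → (Fin n → Fin n → Fin m) → Set
SymbolicUltrametric δ =
  (∀ x y → x ≢ y → δ x y ≡ δ y x)
  × (∀ u v x y → u ≢ v → u ≢ x → u ≢ y → v ≢ x → v ≢ y → x ≢ y →
       ¬ ((δ x y ≡ δ y u) × (δ y u ≡ δ u v) × (δ u v ≢ δ y v) ×
          (δ y v ≡ δ x v) × (δ x v ≡ δ x u)))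
  × (∀ u v x → u ≢ v → u ≢ x → v ≢ x →
       (δ u v ≡ δ u x) ⊎ (δ u v ≡ δ v x) ⊎ (δ u x ≡ δ v x))

FitchMap : ∀ {n k} → (Fin n → Fin n → Subset k) → Set
FitchMap {n} {k} ε = Σ[ T ∈ Clusters n ] Σ[ lam ∈ (Subset n → Subset n → Subset k) ]
  (IsTree T × ExplainsE T lam ε)

-- (T,t) is the tree (T_δ,t_δ): explains δ and t is discriminating
IsTδ : ∀ {n m} → (Fin n → Fin n → Fin m) → Clusters n → (Subset n → Fin m) → Set
IsTδ δ T t = IsTree T × ExplainsV T t δ ×
  (∀ A B → Edge T A B → 2 ≤ ∣ B ∣ → t A ≢ t B)

Uneg : ∀ {n k} → (Fin n → Fin n → Subset k) → Fin k → Fin n → Subset n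
Uneg ε j y = tabulate (λ x → ⌊ x ≟ y ⌋ ∨ not (lookup (ε x y) j))

Hε : ∀ {n k} → (Fin n → Fin n → Subset k) → Clusters n
Hε {n} {k} ε A = (A ≡ᵇ ⊤) ∨ any (λ x → A ≡ᵇ ⁅ x ⁆) (allFin n)
         ∨ any (λ y → any (λ j → A ≡ᵇ Uneg ε j y) (allFin k)) (allFin n)

-- λ_ε on the edge of T_ε above the vertex with cluster B
λε : ∀ {n k} → (Fin n → Fin n → Subset k) → Subset n → Subset k
λε {n} {k} ε B = tabulate (λ j → any (λ y → B ≡ᵇ Uneg ε j y) (allFin n))

MinAbove : ∀ {n} → Clusters n → Subset n → Subset n → Set
MinAbove T A C = (T C ≡ true) × (A ⊆ C) × (∀ B → T B ≡ true → A ⊆ B → C ⊆ B)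

weight : ∀ {n k} → Clusters n → (Subset n → Subset n → Subset k) → ℕ
weight {n} {k} T lam = sum (concatMap (λ A → map (λ B →
                 if isEdge T A B then ∣ lam A B ∣ else 0) (allSubsets n)) (allSubsets n))

-- Every tree explaining δ refines T_δ: were a cluster B of T_δ missing from such a tree T, the
-- smallest cluster C of T above B would carry the label of the parent of B in T_δ, which differs
-- from the label of B since t_δ is discriminating, and then B would fit inside a child of C.
-- Every tree explaining ε contains each U_{¬j}[y], namely as the cluster below the lowest
-- j-labelled edge above y.  Hence H(T_δ) ∪ H(T_ε) lies in every explaining tree, so it is a
-- hierarchy, and conversely its tree T*, labelled by t_δ of the smallest T_δ-cluster above and by
-- λ_ε, explains (δ, ε).  Contracting an inner edge of T* loses a cluster every explaining tree
-- has, while a cluster outside T* can always be contracted away.  Finally λ_ε is contained edgewise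
-- in every edge labelling of T* explaining ε, whence weight minimality and its equality case.
-- T_δ itself is obtained from any tree explaining δ by contracting edges with equal end labels.

module Submission where

open import Defs
open import Data.Nat using (ℕ; _≤_)
open import Data.Bool using (_∨_)
open import Data.Fin using (Fin)
open import Data.Fin.Subset using (Subset; ∣_∣)
open import Data.Product using (Σ; _×_; ∃; Σ-syntax; ∃-syntax)
open import Relation.Binary.PropositionalEquality using (_≡_)
open import Function.Bundles using (_⇔_)

open import Data.Nat using (suc; _<_; _∸_; _+_; z≤n)
import Data.Nat.Properties as ℕ
open import Data.Nat.Induction using (<-wellFounded)
open import Data.Nat.ListAction.Properties using (sum-++)
open import Data.Bool using (Bool; true; false; _∧_; not; if_then_else_)
open import Data.Fin using () renaming (_≟_ to _≟ᶠ_)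
import Data.Fin.Properties as Fin
open import Data.Fin.Subset using (_∈_; _∉_; _⊆_; _⊈_; _⊂_; ⁅_⁆; ⊤; ⊥; _∩_; _∪_; Nonempty)
open import Data.Fin.Subset.Properties
open import Data.Vec using ([]; _∷_; here; there; tabulate; lookup)
import Data.Vec.Properties as Vec
open import Data.List using (List; []; _∷_; map; _++_; concat; allFin)
open import Data.List.Membership.Propositional using () renaming (_∈_ to _∈ˡ_)
open import Data.List.Membership.Propositional.Properties using (∈-++⁺ˡ; ∈-++⁺ʳ; ∈-map⁺; ∈-allFin)
open import Data.List.Relation.Unary.Any using (here; there; satisfied)
open import Data.List.Relation.Unary.Any.Properties using (any⁺; any⁻)
import Data.List.Relation.Unary.Any as Any
open import Data.List.Properties using (map-∘)
open import Data.Bool.ListAction using (any)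
open import Data.Nat.ListAction using (sum)
open import Data.Bool.Properties using (T-≡)
open import Data.Product using (_,_; proj₁; proj₂)
open import Data.Sum using (_⊎_; inj₁; inj₂)
open import Data.Empty using (⊥-elim) renaming (⊥ to Empty)
open import Relation.Binary.PropositionalEquality using (_≢_; refl; sym; trans; cong; subst; module ≡-Reasoning)
open import Relation.Binary.Construct.On as On using ()
open import Relation.Nullary using (¬_; Dec; yes; no; ¬?)
open import Relation.Nullary.Decidable using (⌊_⌋; _×-dec_; decidable-stable)
open import Relation.Unary using (Pred; Decidable)
open import Induction.WellFounded as WF using ()
open import Function.Base using (_∘_)
import Level
open import Function.Bundles using (mk⇔; Equivalence)

∧-true⁻ : ∀ {a b} → a ∧ b ≡ true → a ≡ true × b ≡ true
∧-true⁻ {true} b≡true = refl , b≡true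

∧-true⁺ : ∀ {a b} → a ≡ true → b ≡ true → a ∧ b ≡ true
∧-true⁺ refl refl = refl

∨-true⁻ : ∀ {a b} → a ∨ b ≡ true → a ≡ true ⊎ b ≡ true
∨-true⁻ {true} _ = inj₁ refl
∨-true⁻ {false} b≡true = inj₂ b≡true

∨-trueˡ : ∀ {a} b → a ≡ true → a ∨ b ≡ true
∨-trueˡ b refl = refl

∨-trueʳ : ∀ a {b} → b ≡ true → a ∨ b ≡ true
∨-trueʳ true _ = refl
∨-trueʳ false b≡true = b≡true

not-true⁻ : ∀ {a} → not a ≡ true → a ≡ false
not-true⁻ {false} _ = refl

not-true⁺ : ∀ {a} → a ≡ false → not a ≡ true
not-true⁺ refl = refl

true≢false : ∀ {a} → a ≡ true → a ≡ false → Empty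
true≢false refl ()

false-if-¬true : ∀ {a} → ¬ (a ≡ true) → a ≡ false
false-if-¬true {true} ¬a = ⊥-elim (¬a refl)
false-if-¬true {false} _ = refl

≡-if-true⇔true : ∀ {a b} → (a ≡ true → b ≡ true) → (b ≡ true → a ≡ true) → a ≡ b
≡-if-true⇔true {true} a⇒b _ = sym (a⇒b refl)
≡-if-true⇔true {false} {true} _ b⇒a = b⇒a refl
≡-if-true⇔true {false} {false} _ _ = refl

⌊⌋-true⁻ : ∀ {P : Set} (P? : Dec P) → ⌊ P? ⌋ ≡ true → P
⌊⌋-true⁻ (yes p) _ = p

⌊⌋-true⁺ : ∀ {P : Set} (P? : Dec P) → P → ⌊ P? ⌋ ≡ true
⌊⌋-true⁺ (yes _) _ = refl
⌊⌋-true⁺ (no ¬p) p = ⊥-elim (¬p p)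

true? : ∀ (b : Bool) → Dec (b ≡ true)
true? b = b Data.Bool.≟ true

_≟ˢ_ : ∀ {n} (A B : Subset n) → Dec (A ≡ B)
_≟ˢ_ = Vec.≡-dec Data.Bool._≟_

≡ᵇ⇒≡ : ∀ {n} {A B : Subset n} → A ≡ᵇ B ≡ true → A ≡ B
≡ᵇ⇒≡ {A = []} {[]} _ = refl
≡ᵇ⇒≡ {A = true ∷ A} {true ∷ B} p = cong (true ∷_) (≡ᵇ⇒≡ p)
≡ᵇ⇒≡ {A = false ∷ A} {false ∷ B} p = cong (false ∷_) (≡ᵇ⇒≡ p)

≡ᵇ-refl : ∀ {n} (A : Subset n) → A ≡ᵇ A ≡ true
≡ᵇ-refl [] = refl
≡ᵇ-refl (true ∷ A) = ≡ᵇ-refl A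
≡ᵇ-refl (false ∷ A) = ≡ᵇ-refl A

≡⇒≡ᵇ : ∀ {n} {A B : Subset n} → A ≡ B → A ≡ᵇ B ≡ true
≡⇒≡ᵇ {A = A} refl = ≡ᵇ-refl A

≢⇒≡ᵇ-false : ∀ {n} {A B : Subset n} → A ≢ B → A ≡ᵇ B ≡ false
≢⇒≡ᵇ-false A≢B = false-if-¬true (λ p → A≢B (≡ᵇ⇒≡ p))

⊆ᵇ⇒⊆ : ∀ {n} {A B : Subset n} → A ⊆ᵇ B ≡ true → A ⊆ B
⊆ᵇ⇒⊆ {A = true ∷ A} {true ∷ B} p here = here
⊆ᵇ⇒⊆ {A = true ∷ A} {true ∷ B} p (there x∈A) = there (⊆ᵇ⇒⊆ p x∈A)
⊆ᵇ⇒⊆ {A = false ∷ A} {b ∷ B} p (there x∈A) = there (⊆ᵇ⇒⊆ p x∈A)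

⊆⇒⊆ᵇ : ∀ {n} {A B : Subset n} → A ⊆ B → A ⊆ᵇ B ≡ true
⊆⇒⊆ᵇ {A = []} {[]} _ = refl
⊆⇒⊆ᵇ {A = true ∷ A} {true ∷ B} A⊆B = ⊆⇒⊆ᵇ (drop-∷-⊆ A⊆B)
⊆⇒⊆ᵇ {A = true ∷ A} {false ∷ B} A⊆B with () ← A⊆B here
⊆⇒⊆ᵇ {A = false ∷ A} {b ∷ B} A⊆B = ⊆⇒⊆ᵇ (drop-∷-⊆ A⊆B)

⊈⇒∃∉ : ∀ {n} {A B : Subset n} → A ⊈ B → ∃ λ x → x ∈ A × x ∉ B
⊈⇒∃∉ {A = A} {B} A⊈B with Fin.any? (λ x → (x ∈? A) ×-dec ¬? (x ∈? B))
... | yes witness = witness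
... | no ∄ = ⊥-elim (A⊈B (λ {x} x∈A → decidable-stable (x ∈? B) (λ x∉B → ∄ (x , x∈A , x∉B))))

⊆∧≢⇒⊂ : ∀ {n} {A B : Subset n} → A ⊆ B → A ≢ B → A ⊂ B
⊆∧≢⇒⊂ A⊆B A≢B = A⊆B , ⊈⇒∃∉ (λ B⊆A → A≢B (⊆-antisym A⊆B B⊆A))

⊂⇒≢ : ∀ {n} {A B : Subset n} → A ⊂ B → A ≢ B
⊂⇒≢ A⊂B A≡B = ⊂-irref A≡B A⊂B

⊆⇒≡⊎⊂ : ∀ {n} {A B : Subset n} → A ⊆ B → A ≡ B ⊎ A ⊂ B
⊆⇒≡⊎⊂ {A = A} {B} A⊆B with A ≟ˢ B
... | yes A≡B = inj₁ A≡B
... | no A≢B = inj₂ (⊆∧≢⇒⊂ A⊆B A≢B)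

⊂ᵇ⇒⊂ : ∀ {n} {A B : Subset n} → A ⊂ᵇ B ≡ true → A ⊂ B
⊂ᵇ⇒⊂ p with ∧-true⁻ p
... | A⊆B , A≢B = ⊆∧≢⇒⊂ (⊆ᵇ⇒⊆ A⊆B) (λ A≡B → true≢false (≡⇒≡ᵇ A≡B) (not-true⁻ A≢B))

⊂⇒⊂ᵇ : ∀ {n} {A B : Subset n} → A ⊂ B → A ⊂ᵇ B ≡ true
⊂⇒⊂ᵇ A⊂B = ∧-true⁺ (⊆⇒⊆ᵇ (p⊂q⇒p⊆q A⊂B)) (not-true⁺ (≢⇒≡ᵇ-false (⊂⇒≢ A⊂B)))

⊆∧∣∣≥⇒≡ : ∀ {n} {A B : Subset n} → A ⊆ B → ∣ B ∣ ≤ ∣ A ∣ → A ≡ B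
⊆∧∣∣≥⇒≡ A⊆B ∣B∣≤∣A∣ with ⊆⇒≡⊎⊂ A⊆B
... | inj₁ A≡B = A≡B
... | inj₂ A⊂B = ⊥-elim (ℕ.<⇒≱ (p⊂q⇒∣p∣<∣q∣ A⊂B) ∣B∣≤∣A∣)

⁅⁆⊆ : ∀ {n} {x : Fin n} {A : Subset n} → x ∈ A → ⁅ x ⁆ ⊆ A
⁅⁆⊆ {x = x} x∈A y∈⁅x⁆ with refl ← x∈⁅y⁆⇒x≡y x y∈⁅x⁆ = x∈A

2≤∣∣⇒≢⁅⁆ : ∀ {n} {A : Subset n} → 2 ≤ ∣ A ∣ → ∀ x → A ≢ ⁅ x ⁆
2≤∣∣⇒≢⁅⁆ 2≤∣A∣ x refl = ℕ.<⇒≱ 2≤∣A∣ (ℕ.≤-reflexive (∣⁅x⁆∣≡1 x))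

2≤∣∣⇒⁅⁆⊂ : ∀ {n} {x : Fin n} {A : Subset n} → x ∈ A → 2 ≤ ∣ A ∣ → ⁅ x ⁆ ⊂ A
2≤∣∣⇒⁅⁆⊂ {x = x} x∈A 2≤∣A∣ = ⊆∧≢⇒⊂ (⁅⁆⊆ x∈A) (λ eq → 2≤∣∣⇒≢⁅⁆ 2≤∣A∣ x (sym eq))

⁅⁆⊎2≤∣∣ : ∀ {n} {x : Fin n} {A : Subset n} → x ∈ A → A ≡ ⁅ x ⁆ ⊎ 2 ≤ ∣ A ∣
⁅⁆⊎2≤∣∣ {x = x} {A} x∈A with 2 ℕ.≤? ∣ A ∣
... | yes 2≤∣A∣ = inj₂ 2≤∣A∣
... | no 2≰∣A∣ = inj₁ (sym (⊆∧∣∣≥⇒≡ (⁅⁆⊆ x∈A)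
        (subst (∣ A ∣ ≤_) (sym (∣⁅x⁆∣≡1 x)) (ℕ.≤-pred (ℕ.≰⇒> 2≰∣A∣)))))

∈-tabulate⁺ : ∀ {n} (f : Fin n → Bool) {x} → f x ≡ true → x ∈ tabulate f
∈-tabulate⁺ f {x} fx = Vec.lookup⇒[]= x (tabulate f) (trans (Vec.lookup∘tabulate f x) fx)

∈-tabulate⁻ : ∀ {n} (f : Fin n → Bool) {x} → x ∈ tabulate f → f x ≡ true
∈-tabulate⁻ f {x} x∈ = trans (sym (Vec.lookup∘tabulate f x)) (Vec.[]=⇒lookup x∈)

∉⇒lookup≡false : ∀ {n} {x : Fin n} {A : Subset n} → x ∉ A → lookup A x ≡ false
∉⇒lookup≡false {x = x} {A} x∉A = false-if-¬true (λ p → x∉A (Vec.lookup⇒[]= x A p))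

lookup≡false⇒∉ : ∀ {n} {x : Fin n} {A : Subset n} → lookup A x ≡ false → x ∉ A
lookup≡false⇒∉ p x∈A = true≢false (Vec.[]=⇒lookup x∈A) p

∈-allSubsets : ∀ {n} (A : Subset n) → A ∈ˡ allSubsets n
∈-allSubsets [] = here refl
∈-allSubsets (true ∷ A) = ∈-++⁺ˡ (∈-map⁺ (true ∷_) (∈-allSubsets A))
∈-allSubsets {suc n} (false ∷ A) = ∈-++⁺ʳ (map (true ∷_) (allSubsets n)) (∈-map⁺ (false ∷_) (∈-allSubsets A))

any-true⁺ : ∀ {a} {X : Set a} (f : X → Bool) {xs x} → x ∈ˡ xs → f x ≡ true → any f xs ≡ true
any-true⁺ f x∈xs fx = Equivalence.to T-≡ (any⁺ f (Any.map (λ { refl → Equivalence.from T-≡ fx }) x∈xs))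

any-true⁻ : ∀ {a} {X : Set a} (f : X → Bool) xs → any f xs ≡ true → ∃ λ x → f x ≡ true
any-true⁻ f xs p with x , fx ← satisfied (any⁻ f xs (Equivalence.from T-≡ p)) = x , Equivalence.to T-≡ fx

any-false⁻ : ∀ {a} {X : Set a} (f : X → Bool) {xs x} → any f xs ≡ false → x ∈ˡ xs → f x ≡ false
any-false⁻ f p x∈xs = false-if-¬true (λ fx → true≢false (any-true⁺ f x∈xs fx) p)

measure-rec : ∀ {a ℓ} {A : Set a} (μ : A → ℕ) (P : A → Set ℓ) →
  (∀ x → (∀ y → μ y < μ x → P y) → P x) → ∀ x → P x
measure-rec {ℓ = ℓ} μ P step =
  WF.All.wfRec (On.wellFounded μ <-wellFounded) ℓ P (λ x rec → step x (λ y → rec))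

minimum-by : ∀ {n} {P : Pred (Subset n) Level.zero} → Decidable P → (μ : Subset n → ℕ) →
  ∀ {A} → P A → ∃ λ C → P C × ∀ D → P D → μ C ≤ μ D
minimum-by {n} {P} P? μ {A} = measure-rec μ (λ A → P A → ∃ λ C → P C × ∀ D → P D → μ C ≤ μ D) step A
  where
  step : ∀ A → (∀ B → μ B < μ A → P B → ∃ λ C → P C × ∀ D → P D → μ C ≤ μ D) →
         P A → ∃ λ C → P C × ∀ D → P D → μ C ≤ μ D
  step A rec pA with anySubset? (λ D → P? D ×-dec (μ D ℕ.<? μ A))
  ... | yes (D , pD , μD<μA) = rec D μD<μA pD
  ... | no ∄ = A , pA , λ D pD → ℕ.≮⇒≥ (λ μD<μA → ∄ (D , pD , μD<μA))

sum-map-mono : ∀ {a} {X : Set a} {f g : X → ℕ} → (∀ x → f x ≤ g x) →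
  ∀ xs → sum (map f xs) ≤ sum (map g xs)
sum-map-mono f≤g [] = z≤n
sum-map-mono f≤g (x ∷ xs) = ℕ.+-mono-≤ (f≤g x) (sum-map-mono f≤g xs)

sum-map-< : ∀ {a} {X : Set a} {f g : X → ℕ} → (∀ x → f x ≤ g x) →
  ∀ {xs x} → x ∈ˡ xs → f x < g x → sum (map f xs) < sum (map g xs)
sum-map-< f≤g {xs = x ∷ xs} (here refl) fx<gx = ℕ.+-mono-<-≤ fx<gx (sum-map-mono f≤g xs)
sum-map-< f≤g {xs = x ∷ xs} (there y∈xs) fy<gy = ℕ.+-mono-≤-< (f≤g x) (sum-map-< f≤g y∈xs fy<gy)

sum-concat : ∀ (xss : List (List ℕ)) → sum (concat xss) ≡ sum (map sum xss)
sum-concat [] = refl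
sum-concat (xs ∷ xss) = trans (sum-++ xs (concat xss)) (cong (sum xs +_) (sum-concat xss))

module EdgeOf {n} (T : Clusters n) {A B : Subset n} where

  private
    between : Subset n → Bool
    between C = T C ∧ (B ⊂ᵇ C) ∧ (C ⊂ᵇ A)

    edge⁻ : Edge T A B →
      T A ≡ true × T B ≡ true × (B ⊂ᵇ A) ≡ true × not (any between (allSubsets n)) ≡ true
    edge⁻ e = let (A∈T , r) = ∧-true⁻ {T A} e
                  (B∈T , r′) = ∧-true⁻ {T B} r
                  (B⊂A , none) = ∧-true⁻ {B ⊂ᵇ A} r′
              in A∈T , B∈T , B⊂A , none

  edge-upper∈ : Edge T A B → T A ≡ true
  edge-upper∈ e = proj₁ (edge⁻ e)

  edge-lower∈ : Edge T A B → T B ≡ true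
  edge-lower∈ e = proj₁ (proj₂ (edge⁻ e))

  edge-⊂ : Edge T A B → B ⊂ A
  edge-⊂ e = ⊂ᵇ⇒⊂ (proj₁ (proj₂ (proj₂ (edge⁻ e))))

  edge-tight : Edge T A B → ∀ C → T C ≡ true → B ⊂ C → ¬ C ⊂ A
  edge-tight e C C∈T B⊂C C⊂A = true≢false
    (∧-true⁺ C∈T (∧-true⁺ (⊂⇒⊂ᵇ B⊂C) (⊂⇒⊂ᵇ C⊂A)))
    (any-false⁻ between (not-true⁻ (proj₂ (proj₂ (proj₂ (edge⁻ e))))) (∈-allSubsets C))

  edge⁺ : T A ≡ true → T B ≡ true → B ⊂ A → (∀ C → T C ≡ true → B ⊂ C → ¬ C ⊂ A) → Edge T A B
  edge⁺ A∈T B∈T B⊂A tight = ∧-true⁺ A∈T (∧-true⁺ B∈T (∧-true⁺ (⊂⇒⊂ᵇ B⊂A) (not-true⁺ none)))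
    where
    none : any between (allSubsets n) ≡ false
    none = false-if-¬true λ p → let (C , q) = any-true⁻ between (allSubsets n) p
                                    (C∈T , r) = ∧-true⁻ q
                                    (B⊂C , C⊂A) = ∧-true⁻ r
                                in tight C C∈T (⊂ᵇ⇒⊂ B⊂C) (⊂ᵇ⇒⊂ C⊂A)

IsLca-unique : ∀ {n} {T : Clusters n} {x y C D} → IsLca T x y C → IsLca T x y D → C ≡ D
IsLca-unique (C∈T , x∈C , y∈C , C-least) (D∈T , x∈D , y∈D , D-least) =
  ⊆-antisym (C-least _ D∈T x∈D y∈D) (D-least _ C∈T x∈C y∈C)

IsLca-sym : ∀ {n} {T : Clusters n} {x y C} → IsLca T x y C → IsLca T y x C
IsLca-sym (C∈T , x∈C , y∈C , C-least) = C∈T , y∈C , x∈C , λ B B∈T y∈B x∈B → C-least B B∈T x∈B y∈B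

ChildToward : ∀ {n} → Clusters n → Subset n → Fin n → Subset n → Set
ChildToward T C x D = (T D ≡ true) × x ∈ D × D ⊂ C × (∀ E → T E ≡ true → x ∈ E → E ⊂ C → E ⊆ D)

module Tree {n} (T : Clusters n) (isT : IsTree T) where

  open EdgeOf T public

  ⊤∈ : T ⊤ ≡ true
  ⊤∈ = proj₁ (proj₁ isT)

  ⁅⁆∈ : ∀ x → T ⁅ x ⁆ ≡ true
  ⁅⁆∈ = proj₁ (proj₂ (proj₁ isT))

  ⊥∉ : T ⊥ ≡ false
  ⊥∉ = proj₂ isT

  nested : ∀ {A B x} → T A ≡ true → T B ≡ true → x ∈ A → x ∈ B → A ⊆ B ⊎ B ⊆ A
  nested {A} {B} {x} A∈T B∈T x∈A x∈B with proj₂ (proj₂ (proj₁ isT)) A B A∈T B∈T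
  ... | inj₁ A∩B≡A = inj₁ (λ z∈A → proj₂ (x∈p∩q⁻ A B (subst (_ ∈_) (sym A∩B≡A) z∈A)))
  ... | inj₂ (inj₁ A∩B≡B) = inj₂ (λ z∈B → proj₁ (x∈p∩q⁻ A B (subst (_ ∈_) (sym A∩B≡B) z∈B)))
  ... | inj₂ (inj₂ A∩B≡⊥) = ⊥-elim (∉⊥ (subst (x ∈_) A∩B≡⊥ (x∈p∩q⁺ (x∈A , x∈B))))

  nested-trichotomy : ∀ {A B x} → T A ≡ true → T B ≡ true → x ∈ A → x ∈ B → A ≡ B ⊎ A ⊂ B ⊎ B ⊂ A
  nested-trichotomy A∈T B∈T x∈A x∈B with nested A∈T B∈T x∈A x∈B
  ... | inj₁ A⊆B = Data.Sum.map₂ inj₁ (⊆⇒≡⊎⊂ A⊆B)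
  ... | inj₂ B⊆A = Data.Sum.map sym inj₂ (⊆⇒≡⊎⊂ B⊆A)

  nonempty : ∀ {B} → T B ≡ true → Nonempty B
  nonempty {B} B∈T with nonempty? B
  ... | yes ne = ne
  ... | no empty = ⊥-elim (true≢false (subst (λ X → T X ≡ true) (Empty-unique empty) B∈T) ⊥∉)

  private
    smallestAbove : ∀ S → ∃ λ C → (T C ≡ true × S ⊆ C) × ∀ D → T D ≡ true × S ⊆ D → ∣ C ∣ ≤ ∣ D ∣
    smallestAbove S = minimum-by (λ C → true? (T C) ×-dec (S ⊆? C)) ∣_∣ (⊤∈ , ⊆⊤)

  minAbove : Subset n → Subset n
  minAbove S = proj₁ (smallestAbove S)

  minAbove-spec : ∀ {S x} → x ∈ S → MinAbove T S (minAbove S)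
  minAbove-spec {S} {x} x∈S with smallestAbove S
  ... | C , (C∈T , S⊆C) , smallest = C∈T , S⊆C , least
    where
    least : ∀ B → T B ≡ true → S ⊆ B → C ⊆ B
    least B B∈T S⊆B with nested C∈T B∈T (S⊆C x∈S) (S⊆B x∈S)
    ... | inj₁ C⊆B = C⊆B
    ... | inj₂ B⊆C = ⊆-reflexive (sym (⊆∧∣∣≥⇒≡ B⊆C (smallest B (B∈T , S⊆B))))

  lca : Fin n → Fin n → Subset n
  lca x y = minAbove (⁅ x ⁆ ∪ ⁅ y ⁆)

  lca-spec : ∀ x y → IsLca T x y (lca x y)
  lca-spec x y with minAbove-spec {⁅ x ⁆ ∪ ⁅ y ⁆} (x∈p∪q⁺ (inj₁ (x∈⁅x⁆ x)))
  ... | C∈T , xy⊆C , least = C∈T , xy⊆C (x∈p∪q⁺ (inj₁ (x∈⁅x⁆ x))) , xy⊆C (x∈p∪q⁺ (inj₂ (x∈⁅x⁆ y))) ,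
        λ B B∈T x∈B y∈B → least B B∈T (λ z∈xy → Data.Sum.[ (λ z∈x → ⁅⁆⊆ x∈B z∈x) , (λ z∈y → ⁅⁆⊆ y∈B z∈y) ]
                                                 (x∈p∪q⁻ ⁅ x ⁆ ⁅ y ⁆ z∈xy))

  lca∈T : ∀ x y → T (lca x y) ≡ true
  lca∈T x y = proj₁ (lca-spec x y)

  x∈lca : ∀ x y → x ∈ lca x y
  x∈lca x y = proj₁ (proj₂ (lca-spec x y))

  y∈lca : ∀ x y → y ∈ lca x y
  y∈lca x y = proj₁ (proj₂ (proj₂ (lca-spec x y)))

  lca-least : ∀ x y B → T B ≡ true → x ∈ B → y ∈ B → lca x y ⊆ B
  lca-least x y = proj₂ (proj₂ (proj₂ (lca-spec x y)))

  lca-comm : ∀ x y → lca x y ≡ lca y x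
  lca-comm x y = IsLca-unique (lca-spec x y) (IsLca-sym (lca-spec y x))

  parent : ∀ {B} → T B ≡ true → B ≢ ⊤ → ∃ λ A → Edge T A B
  parent {B} B∈T B≢⊤ with minimum-by (λ A → true? (T A) ×-dec (B ⊂? A)) ∣_∣
                            (⊤∈ , ⊆∧≢⇒⊂ ⊆⊤ B≢⊤)
  ... | A , (A∈T , B⊂A) , smallest =
    A , edge⁺ A∈T B∈T B⊂A (λ C C∈T B⊂C C⊂A → ℕ.<⇒≱ (p⊂q⇒∣p∣<∣q∣ C⊂A) (smallest C (C∈T , B⊂C)))

  edge⇒childToward : ∀ {A B x} → Edge T A B → x ∈ B → ChildToward T A x B
  edge⇒childToward {A} {B} e x∈B = edge-lower∈ e , x∈B , edge-⊂ e , maximal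
    where
    maximal : ∀ E → T E ≡ true → _ ∈ E → E ⊂ A → E ⊆ B
    maximal E E∈T x∈E E⊂A with nested-trichotomy E∈T (edge-lower∈ e) x∈E x∈B
    ... | inj₁ E≡B = ⊆-reflexive E≡B
    ... | inj₂ (inj₁ E⊂B) = p⊂q⇒p⊆q E⊂B
    ... | inj₂ (inj₂ B⊂E) = ⊥-elim (edge-tight e E E∈T B⊂E E⊂A)

  childToward : ∀ {C x} → T C ≡ true → ⁅ x ⁆ ⊂ C → ∃ (ChildToward T C x)
  childToward {C} {x} C∈T x⊂C
    with minimum-by (λ E → true? (T E) ×-dec ((x ∈? E) ×-dec (E ⊂? C))) (λ E → n ∸ ∣ E ∣)
                    (⁅⁆∈ x , x∈⁅x⁆ x , x⊂C)
  ... | D , (D∈T , x∈D , D⊂C) , largest = D , D∈T , x∈D , D⊂C , maximal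
    where
    maximal : ∀ E → T E ≡ true → x ∈ E → E ⊂ C → E ⊆ D
    maximal E E∈T x∈E E⊂C with nested E∈T D∈T x∈E x∈D
    ... | inj₁ E⊆D = E⊆D
    ... | inj₂ D⊆E with ∣ E ∣ ℕ.≤? ∣ D ∣
    ...   | yes ∣E∣≤∣D∣ = ⊆-reflexive (sym (⊆∧∣∣≥⇒≡ D⊆E ∣E∣≤∣D∣))
    ...   | no ∣E∣≰∣D∣ = ⊥-elim (ℕ.<⇒≱ (ℕ.∸-monoʳ-< (ℕ.≰⇒> ∣E∣≰∣D∣) (∣p∣≤n E))
                                       (largest E (E∈T , x∈E , E⊂C)))

  childToward⇒IsLca : ∀ {C x D y} → T C ≡ true → ChildToward T C x D → y ∈ C → y ∉ D → IsLca T x y C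
  childToward⇒IsLca {C} {x} {D} {y} C∈T (D∈T , x∈D , D⊂C , maximal) y∈C y∉D =
    C∈T , p⊂q⇒p⊆q D⊂C x∈D , y∈C , least
    where
    least : ∀ B → T B ≡ true → x ∈ B → y ∈ B → C ⊆ B
    least B B∈T x∈B y∈B with nested-trichotomy C∈T B∈T (p⊂q⇒p⊆q D⊂C x∈D) x∈B
    ... | inj₁ C≡B = ⊆-reflexive C≡B
    ... | inj₂ (inj₁ C⊂B) = p⊂q⇒p⊆q C⊂B
    ... | inj₂ (inj₂ B⊂C) = ⊥-elim (y∉D (maximal B B∈T x∈B B⊂C y∈B))

  edge⇒IsLca : ∀ {A B x y} → Edge T A B → y ∈ B → x ∈ A → x ∉ B → IsLca T y x A
  edge⇒IsLca e y∈B = childToward⇒IsLca (edge-upper∈ e) (edge⇒childToward e y∈B)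

  parent-unique : ∀ {A A′ B} → Edge T A B → Edge T A′ B → A ≡ A′
  parent-unique {A} {A′} e e′ with x , x∈B ← nonempty (edge-lower∈ e)
    with nested-trichotomy (edge-upper∈ e) (edge-upper∈ e′) (p⊂q⇒p⊆q (edge-⊂ e) x∈B) (p⊂q⇒p⊆q (edge-⊂ e′) x∈B)
  ... | inj₁ A≡A′ = A≡A′
  ... | inj₂ (inj₁ A⊂A′) = ⊥-elim (edge-tight e′ A (edge-upper∈ e) (edge-⊂ e) A⊂A′)
  ... | inj₂ (inj₂ A′⊂A) = ⊥-elim (edge-tight e A′ (edge-upper∈ e′) (edge-⊂ e′) A′⊂A)

  inner⇒IsLca : ∀ {A} → T A ≡ true → 2 ≤ ∣ A ∣ → ∃ λ x → ∃ λ y → x ≢ y × IsLca T x y A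
  inner⇒IsLca A∈T 2≤∣A∣ with x , x∈A ← nonempty A∈T
    with D , child@(_ , x∈D , (_ , y , y∈A , y∉D) , _) ← childToward A∈T (2≤∣∣⇒⁅⁆⊂ x∈A 2≤∣A∣) =
    x , y , (λ { refl → y∉D x∈D }) , childToward⇒IsLca A∈T child y∈A y∉D

  childToward-disjoint : ∀ {C r Dr b Db y} → ChildToward T C r Dr → ChildToward T C b Db →
    b ∉ Dr → y ∈ Dr → y ∉ Db
  childToward-disjoint (Dr∈T , r∈Dr , Dr⊂C , Dr-max) (Db∈T , b∈Db , Db⊂C , Db-max) b∉Dr y∈Dr y∈Db
    with nested Dr∈T Db∈T y∈Dr y∈Db
  ... | inj₁ Dr⊆Db = b∉Dr (Dr-max _ Db∈T (Dr⊆Db r∈Dr) Db⊂C b∈Db)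
  ... | inj₂ Db⊆Dr = b∉Dr (Db⊆Dr b∈Db)

  edge-lower≢⊤ : ∀ {A B} → Edge T A B → B ≢ ⊤
  edge-lower≢⊤ e refl = ⊂⇒≢ (⊆-⊂-trans ⊆⊤ (edge-⊂ e)) refl

  edge-upper⊆lca : ∀ {A B C x y} → Edge T A B → y ∈ B → x ∉ B → IsLca T x y C → A ⊆ C
  edge-upper⊆lca e y∈B x∉B (C∈T , x∈C , y∈C , _)
    with nested (edge-upper∈ e) C∈T (p⊂q⇒p⊆q (edge-⊂ e) y∈B) y∈C
  ... | inj₁ A⊆C = A⊆C
  ... | inj₂ C⊆A with ⊆⇒≡⊎⊂ C⊆A | nested (edge-lower∈ e) C∈T y∈B y∈C
  ...   | inj₁ C≡A | _ = ⊆-reflexive (sym C≡A)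
  ...   | inj₂ _ | inj₂ C⊆B = ⊥-elim (x∉B (C⊆B x∈C))
  ...   | inj₂ C⊂A | inj₁ B⊆C with ⊆⇒≡⊎⊂ B⊆C
  ...     | inj₁ refl = ⊥-elim (x∉B x∈C)
  ...     | inj₂ B⊂C = ⊥-elim (edge-tight e _ C∈T B⊂C C⊂A)

module _ {n} (T : Clusters n) (B : Subset n) where

  contract⁻ : ∀ {A} → contract T B A ≡ true → T A ≡ true × A ≢ B
  contract⁻ {A} p with A∈T , A≢ᵇB ← ∧-true⁻ {T A} p =
    A∈T , λ A≡B → true≢false (≡⇒≡ᵇ A≡B) (not-true⁻ A≢ᵇB)

  contract⁺ : ∀ {A} → T A ≡ true → A ≢ B → contract T B A ≡ true
  contract⁺ A∈T A≢B = ∧-true⁺ A∈T (not-true⁺ (≢⇒≡ᵇ-false A≢B))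

  contract-removes : contract T B B ≡ false
  contract-removes = false-if-¬true (λ p → proj₂ (contract⁻ p) refl)

  contract-isTree : IsTree T → B ≢ ⊤ → 2 ≤ ∣ B ∣ → IsTree (contract T B)
  contract-isTree ((⊤∈T , ⁅⁆∈T , laminar) , ⊥∉T) B≢⊤ 2≤∣B∣ =
    ( contract⁺ ⊤∈T (λ ⊤≡B → B≢⊤ (sym ⊤≡B))
    , (λ x → contract⁺ (⁅⁆∈T x) (λ x≡B → 2≤∣∣⇒≢⁅⁆ 2≤∣B∣ x (sym x≡B)))
    , λ A C A∈ C∈ → laminar A C (proj₁ (contract⁻ A∈)) (proj₁ (contract⁻ C∈)) )
    , false-if-¬true (λ ⊥∈ → true≢false (proj₁ (contract⁻ ⊥∈)) ⊥∉T)

module _ {n k} (ε : Fin n → Fin n → Subset k) where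

  private
    inUneg : Fin k → Fin n → Fin n → Bool
    inUneg j y x = ⌊ x ≟ᶠ y ⌋ ∨ not (lookup (ε x y) j)

  ∈Uneg⁻ : ∀ {x j y} → x ∈ Uneg ε j y → x ≡ y ⊎ j ∉ ε x y
  ∈Uneg⁻ {x} {j} {y} x∈U with ∨-true⁻ (∈-tabulate⁻ (inUneg j y) x∈U)
  ... | inj₁ x≡y = inj₁ (⌊⌋-true⁻ (x ≟ᶠ y) x≡y)
  ... | inj₂ j∉ = inj₂ (lookup≡false⇒∉ (not-true⁻ j∉))

  y∈Uneg : ∀ {j y} → y ∈ Uneg ε j y
  y∈Uneg {j} {y} = ∈-tabulate⁺ (inUneg j y) (∨-trueˡ _ (⌊⌋-true⁺ (y ≟ᶠ y) refl))

  ∈Uneg⁺ : ∀ {x j y} → j ∉ ε x y → x ∈ Uneg ε j y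
  ∈Uneg⁺ {x} {j} {y} j∉ = ∈-tabulate⁺ (inUneg j y) (∨-trueʳ (⌊ x ≟ᶠ y ⌋) (not-true⁺ (∉⇒lookup≡false j∉)))

  ∉Uneg⇒∈ε : ∀ {x j y} → x ∉ Uneg ε j y → j ∈ ε x y
  ∉Uneg⇒∈ε {x} {j} {y} x∉U = decidable-stable (j ∈? ε x y) (λ j∉ → x∉U (∈Uneg⁺ j∉))

  ∈ε⇒∉Uneg : ∀ {x j y} → x ≢ y → j ∈ ε x y → x ∉ Uneg ε j y
  ∈ε⇒∉Uneg x≢y j∈ x∈U = Data.Sum.[ x≢y , (λ j∉ → j∉ j∈) ] (∈Uneg⁻ x∈U)

  Hε⁻ : ∀ {A} → Hε ε A ≡ true →
    A ≡ ⊤ ⊎ (∃ λ x → A ≡ ⁅ x ⁆) ⊎ (∃ λ y → ∃ λ j → A ≡ Uneg ε j y)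
  Hε⁻ {A} p with ∨-true⁻ {A ≡ᵇ ⊤} p
  ... | inj₁ A≡⊤ = inj₁ (≡ᵇ⇒≡ A≡⊤)
  ... | inj₂ q with ∨-true⁻ {any (λ x → A ≡ᵇ ⁅ x ⁆) (allFin n)} q
  ...   | inj₁ r = let (x , A≡x) = any-true⁻ _ (allFin n) r in inj₂ (inj₁ (x , ≡ᵇ⇒≡ A≡x))
  ...   | inj₂ r = let (y , s) = any-true⁻ _ (allFin n) r
                       (j , A≡U) = any-true⁻ _ (allFin k) s
                   in inj₂ (inj₂ (y , j , ≡ᵇ⇒≡ A≡U))

  Hε-Uneg : ∀ j y → Hε ε (Uneg ε j y) ≡ true
  Hε-Uneg j y = ∨-trueʳ (U ≡ᵇ ⊤) (∨-trueʳ (any (λ x → U ≡ᵇ ⁅ x ⁆) (allFin n))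
    (any-true⁺ _ (∈-allFin y) (any-true⁺ (λ j′ → U ≡ᵇ Uneg ε j′ y) (∈-allFin j) (≡ᵇ-refl U))))
    where
    U = Uneg ε j y

  λε⁻ : ∀ {B j} → j ∈ λε ε B → ∃ λ y → B ≡ Uneg ε j y
  λε⁻ {B} {j} j∈ with y , B≡U ← any-true⁻ _ (allFin n) (∈-tabulate⁻ _ j∈) = y , ≡ᵇ⇒≡ B≡U

  λε-Uneg : ∀ {j y} → j ∈ λε ε (Uneg ε j y)
  λε-Uneg {j} {y} = ∈-tabulate⁺ _ (any-true⁺ _ (∈-allFin y) (≡ᵇ-refl (Uneg ε j y)))

module Fitch {n k} (ε : Fin n → Fin n → Subset k) (T : Clusters n) (isT : IsTree T)
             (lam : Subset n → Subset n → Subset k) (explains : ExplainsE T lam ε) where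
  open Tree T isT

  ∈ε⇒labelledEdge : ∀ {x y j} → x ≢ y → j ∈ ε x y →
    ∃[ A ] ∃[ B ] (Edge T A B × y ∈ B × A ⊆ lca x y × j ∈ lam A B)
  ∈ε⇒labelledEdge {x} {y} {j} x≢y = Equivalence.to (explains x y x≢y (lca x y) (lca-spec x y) j)

  labelledEdge⇒∈ε : ∀ {A B x y j} → Edge T A B → y ∈ B → x ∉ B → j ∈ lam A B → j ∈ ε x y
  labelledEdge⇒∈ε {A} {B} {x} {y} {j} e y∈B x∉B j∈ =
    Equivalence.from (explains x y x≢y (lca x y) (lca-spec x y) j)
      (A , B , e , y∈B , edge-upper⊆lca e y∈B x∉B (lca-spec x y) , j∈)
    where
    x≢y : x ≢ y
    x≢y refl = x∉B y∈B

  LabelledAbove : Fin k → Fin n → Subset n → Set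
  LabelledAbove j y B = y ∈ B × ∃ λ A → Edge T A B × j ∈ lam A B

  labelledAbove? : ∀ j y B → Dec (LabelledAbove j y B)
  labelledAbove? j y B = (y ∈? B) ×-dec anySubset? (λ A → true? (isEdge T A B) ×-dec (j ∈? lam A B))

  Uneg≡⊤ : ∀ {j y} → (∀ B → ¬ LabelledAbove j y B) → Uneg ε j y ≡ ⊤
  Uneg≡⊤ {j} {y} unlabelled = ⊆-antisym ⊆⊤ (λ {x} _ → everything x)
    where
    everything : ∀ x → x ∈ Uneg ε j y
    everything x with x ≟ᶠ y
    ... | yes refl = y∈Uneg ε
    ... | no x≢y = decidable-stable (x ∈? Uneg ε j y) λ x∉U →
          let (A , B , e , y∈B , _ , j∈) = ∈ε⇒labelledEdge x≢y (∉Uneg⇒∈ε ε x∉U)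
          in unlabelled B (y∈B , A , e , j∈)

  Uneg≡smallestLabelled : ∀ {j y B} → LabelledAbove j y B →
    (∀ B′ → LabelledAbove j y B′ → ∣ B ∣ ≤ ∣ B′ ∣) → Uneg ε j y ≡ B
  Uneg≡smallestLabelled {j} {y} {B} (y∈B , A , e , j∈) smallest = ⊆-antisym U⊆B B⊆U
    where
    U⊆B : Uneg ε j y ⊆ B
    U⊆B {x} x∈U = decidable-stable (x ∈? B) λ x∉B →
      ∈ε⇒∉Uneg ε (λ { refl → x∉B y∈B }) (labelledEdge⇒∈ε e y∈B x∉B j∈) x∈U
    B⊆U : B ⊆ Uneg ε j y
    B⊆U {x} x∈B with x ≟ᶠ y
    ... | yes refl = y∈Uneg ε
    ... | no x≢y = decidable-stable (x ∈? Uneg ε j y) λ x∉U →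
      let (A′ , B′ , e′ , y∈B′ , A′⊆lca , j∈′) = ∈ε⇒labelledEdge x≢y (∉Uneg⇒∈ε ε x∉U)
          B′⊂B = ⊂-⊆-trans (edge-⊂ e′) (⊆-trans A′⊆lca (lca-least x y B (edge-lower∈ e) x∈B y∈B))
      in ℕ.<⇒≱ (p⊂q⇒∣p∣<∣q∣ B′⊂B) (smallest B′ (y∈B′ , A′ , e′ , j∈′))

  Uneg-shape : ∀ j y → Uneg ε j y ≡ ⊤ ⊎ ∃[ A ] ∃[ B ] (Edge T A B × j ∈ lam A B × Uneg ε j y ≡ B)
  Uneg-shape j y with anySubset? (labelledAbove? j y)
  ... | no ∄ = inj₁ (Uneg≡⊤ (λ B labelled → ∄ (B , labelled)))
  ... | yes (_ , labelled₀) with minimum-by (labelledAbove? j y) ∣_∣ labelled₀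
  ...   | B , labelled@(_ , A , e , j∈) , smallest = inj₂ (A , B , e , j∈ , Uneg≡smallestLabelled labelled smallest)

  Hε⊆ : ∀ A → Hε ε A ≡ true → T A ≡ true
  Hε⊆ A A∈Hε with Hε⁻ ε {A} A∈Hε
  ... | inj₁ refl = ⊤∈
  ... | inj₂ (inj₁ (x , refl)) = ⁅⁆∈ x
  ... | inj₂ (inj₂ (y , j , refl)) with Uneg-shape j y
  ...   | inj₁ U≡⊤ = subst (λ X → T X ≡ true) (sym U≡⊤) ⊤∈
  ...   | inj₂ (_ , _ , e , _ , U≡B) = subst (λ X → T X ≡ true) (sym U≡B) (edge-lower∈ e)

  leaving-Uneg⇒∈ε : ∀ {x y z j} → y ∈ Uneg ε j z → x ∉ Uneg ε j z → j ∈ ε x y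
  leaving-Uneg⇒∈ε {x} {y} {z} {j} y∈U x∉U with Uneg-shape j z
  ... | inj₁ U≡⊤ = ⊥-elim (x∉U (subst (x ∈_) (sym U≡⊤) ∈⊤))
  ... | inj₂ (A , B , e , j∈ , U≡B) = labelledEdge⇒∈ε e (subst (y ∈_) U≡B y∈U) (subst (x ∉_) U≡B x∉U) j∈

module Refines {n m} (δ : Fin n → Fin n → Fin m)
               (T : Clusters n) (isT : IsTree T) (t : Subset n → Fin m) (explainsT : ExplainsV T t δ)
               (Tδ : Clusters n) (tδ : Subset n → Fin m) (isTδ : IsTδ δ Tδ tδ) where
  module TT = Tree T isT
  module TD = Tree Tδ (proj₁ isTδ)

  explainsTδ : ExplainsV Tδ tδ δ
  explainsTδ = proj₁ (proj₂ isTδ)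

  -- Where the T-label at C differs from the Tδ-label at B, T cannot separate at C two leaves that
  -- Tδ separates at B, so B lies inside a single child of C.
  module _ {B C} (mismatch : t C ≢ tδ B) (B∈Tδ : Tδ B ≡ true) (C∈T : T C ≡ true) (B⊆C : B ⊆ C) where

    split-at-B⇒joined-below-C : ∀ {b Bb Db y} → ChildToward Tδ B b Bb → ChildToward T C b Db →
      y ∈ B → y ∉ Bb → y ∈ Db
    split-at-B⇒joined-below-C {b} {Bb} {Db} {y} childB@(_ , b∈Bb , _) childC y∈B y∉Bb =
      decidable-stable (y ∈? Db) λ y∉Db → mismatch (begin
        t C     ≡⟨ explainsT b y b≢y C (TT.childToward⇒IsLca C∈T childC (B⊆C y∈B) y∉Db) ⟩
        δ b y   ≡⟨ explainsTδ b y b≢y B (TD.childToward⇒IsLca B∈Tδ childB y∈B y∉Bb) ⟨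
        tδ B    ∎)
      where
      open ≡-Reasoning
      b≢y : b ≢ y
      b≢y refl = y∉Bb b∈Bb

    mismatch⇒inside-child : 2 ≤ ∣ B ∣ → B ⊂ C → ∀ {r} → r ∈ B → ∃ λ D → T D ≡ true × D ⊂ C × B ⊆ D
    mismatch⇒inside-child 2≤∣B∣ B⊂C {r} r∈B
      with TD.childToward B∈Tδ (2≤∣∣⇒⁅⁆⊂ r∈B 2≤∣B∣) | TT.childToward C∈T (⊂-trans (2≤∣∣⇒⁅⁆⊂ r∈B 2≤∣B∣) B⊂C)
    ... | Br , childBr@(_ , r∈Br , (_ , b , b∈B , b∉Br) , _) | Dr , childDr@(Dr∈T , _ , Dr⊂C , Dr-max)
      with TD.childToward B∈Tδ (2≤∣∣⇒⁅⁆⊂ b∈B 2≤∣B∣) | TT.childToward C∈T (⊂-trans (2≤∣∣⇒⁅⁆⊂ b∈B 2≤∣B∣) B⊂C)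
    ... | Bb , childBb | Db , childDb@(Db∈T , _ , Db⊂C , _) =
      Dr , Dr∈T , Dr⊂C , B⊆Dr
      where
      Db⊆Dr : Db ⊆ Dr
      Db⊆Dr = Dr-max Db Db∈T (split-at-B⇒joined-below-C childBb childDb r∈B
                (TD.childToward-disjoint childBr childBb b∉Br r∈Br)) Db⊂C
      B⊆Dr : B ⊆ Dr
      B⊆Dr {y} y∈B with y ∈? Br
      ... | no y∉Br = split-at-B⇒joined-below-C childBr childDr y∈B y∉Br
      ... | yes y∈Br = Db⊆Dr (split-at-B⇒joined-below-C childBb childDb y∈B
                         (TD.childToward-disjoint childBr childBb b∉Br y∈Br))

  parent-label : ∀ {P B C} → Edge Tδ P B → 2 ≤ ∣ B ∣ → T P ≡ true → MinAbove T B C → B ⊂ C →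
    t C ≡ tδ P
  parent-label {P} {B} {C} e 2≤∣B∣ P∈T (C∈T , B⊆C , C-least) (_ , z , z∈C , z∉B)
    with Dz , childDz@(Dz∈T , _ , Dz⊂C , _) ←
           TT.childToward C∈T (2≤∣∣⇒⁅⁆⊂ z∈C (ℕ.≤-trans 2≤∣B∣ (p⊆q⇒∣p∣≤∣q∣ B⊆C)))
    with r , r∈B , r∉Dz ← ⊈⇒∃∉ (λ B⊆Dz → ⊂-irref refl (⊂-⊆-trans Dz⊂C (C-least Dz Dz∈T B⊆Dz))) =
    begin
      t C     ≡⟨ explainsT z r z≢r C (TT.childToward⇒IsLca C∈T childDz (B⊆C r∈B) r∉Dz) ⟩
      δ z r   ≡⟨ explainsTδ z r z≢r P (IsLca-sym (TD.edge⇒IsLca e r∈B z∈P z∉B)) ⟨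
      tδ P    ∎
    where
    open ≡-Reasoning
    z≢r : z ≢ r
    z≢r refl = z∉B r∈B
    z∈P : z ∈ P
    z∈P = C-least P P∈T (p⊂q⇒p⊆q (TD.edge-⊂ e)) z∈C

  child-of-cluster∈T : ∀ {P B} → Edge Tδ P B → 2 ≤ ∣ B ∣ → T P ≡ true → T B ≡ true
  child-of-cluster∈T {P} {B} e 2≤∣B∣ P∈T = decidable-stable (true? (T B)) λ B∉T →
    let B∈Tδ = TD.edge-lower∈ e
        (x , x∈B) = TD.nonempty B∈Tδ
        minC = TT.minAbove-spec x∈B
        (C∈T , B⊆C , C-least) = minC
        B⊂C = ⊆∧≢⇒⊂ B⊆C (λ B≡C → B∉T (subst (λ X → T X ≡ true) (sym B≡C) C∈T))
        mismatch = λ tC≡tδB → proj₂ (proj₂ isTδ) P B e 2≤∣B∣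
                               (trans (sym (parent-label e 2≤∣B∣ P∈T minC B⊂C)) tC≡tδB)
        (D , D∈T , D⊂C , B⊆D) = mismatch⇒inside-child mismatch B∈Tδ C∈T B⊆C 2≤∣B∣ B⊂C x∈B
    in ⊂-irref refl (⊂-⊆-trans D⊂C (C-least D D∈T B⊆D))

  Tδ⊆T : ∀ B → Tδ B ≡ true → T B ≡ true
  Tδ⊆T = measure-rec (λ B → n ∸ ∣ B ∣) (λ B → Tδ B ≡ true → T B ≡ true) step
    where
    step : ∀ B → (∀ A → n ∸ ∣ A ∣ < n ∸ ∣ B ∣ → Tδ A ≡ true → T A ≡ true) → Tδ B ≡ true → T B ≡ true
    step B below B∈Tδ with B ≟ˢ ⊤ | TD.nonempty B∈Tδ
    ... | yes refl | _ = TT.⊤∈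
    ... | no B≢⊤ | x , x∈B with ⁅⁆⊎2≤∣∣ x∈B | TD.parent B∈Tδ B≢⊤
    ...   | inj₁ refl | _ = TT.⁅⁆∈ x
    ...   | inj₂ 2≤∣B∣ | P , e = child-of-cluster∈T e 2≤∣B∣
            (below P (ℕ.∸-monoʳ-< (p⊂q⇒∣p∣<∣q∣ (TD.edge-⊂ e)) (∣p∣≤n P)) (TD.edge-upper∈ e))

module Refinement {n m k} (δ : Fin n → Fin n → Fin m) (ε : Fin n → Fin n → Subset k)
  (Tδ : Clusters n) (tδ : Subset n → Fin m) (isTreeTδ : IsTree Tδ) (explainsTδ : ExplainsV Tδ tδ δ)
  (Tε : Clusters n) (isTreeTε : IsTree Tε) (lamε : Subset n → Subset n → Subset k)
  (explainsTε : ExplainsE Tε lamε ε)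
  (T : Clusters n) (isT : IsTree T)
  (Tδ⊆T : ∀ A → Tδ A ≡ true → T A ≡ true) (Hε⊆T : ∀ A → Hε ε A ≡ true → T A ≡ true) where
  module TD = Tree Tδ isTreeTδ
  open Tree T isT

  explainsV : ExplainsV T (λ A → tδ (TD.minAbove A)) δ
  explainsV x y x≢y C (_ , x∈C , y∈C , C-least)
    with M∈Tδ , C⊆M , M-least ← TD.minAbove-spec x∈C =
    explainsTδ x y x≢y (TD.minAbove C) (M∈Tδ , C⊆M x∈C , C⊆M y∈C ,
      λ E E∈Tδ x∈E y∈E → M-least E E∈Tδ (C-least E (Tδ⊆T E E∈Tδ) x∈E y∈E))

  explainsE : ExplainsE T (λ A B → λε ε B) ε
  explainsE x y x≢y C lcaC@(_ , _ , _ , C-least) j = mk⇔ to from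
    where
    x∉U : j ∈ ε x y → x ∉ Uneg ε j y
    x∉U = ∈ε⇒∉Uneg ε x≢y
    to : j ∈ ε x y → ∃[ A ] ∃[ B ] (Edge T A B × y ∈ B × A ⊆ C × j ∈ λε ε B)
    to j∈ with A , e ← parent (Hε⊆T _ (Hε-Uneg ε j y)) (λ U≡⊤ → x∉U j∈ (subst (x ∈_) (sym U≡⊤) ∈⊤)) =
      A , Uneg ε j y , e , y∈Uneg ε , edge-upper⊆lca e (y∈Uneg ε) (x∉U j∈) lcaC , λε-Uneg ε
    from : ∃[ A ] ∃[ B ] (Edge T A B × y ∈ B × A ⊆ C × j ∈ λε ε B) → j ∈ ε x y
    from (A , B , e , y∈B , A⊆C , j∈) with z , B≡U ← λε⁻ ε j∈ =
      Fitch.leaving-Uneg⇒∈ε ε Tε isTreeTε lamε explainsTε (subst (y ∈_) B≡U y∈B) (subst (x ∉_) B≡U x∉B)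
      where
      x∉B : x ∉ B
      x∉B x∈B = ⊂-irref refl (⊂-⊆-trans (edge-⊂ e) (⊆-trans A⊆C (C-least B (edge-lower∈ e) x∈B y∈B)))

  explains : Explains T δ ε
  explains = _ , _ , explainsV , explainsE

module Ultrametric {n m} (δ : Fin n → Fin n → Fin m)
                   (T : Clusters n) (isT : IsTree T) (t : Subset n → Fin m) (explains : ExplainsV T t δ) where
  open Tree T isT

  label : Fin n → Fin n → Fin m
  label x y = t (lca x y)

  label-comm : ∀ x y → label x y ≡ label y x
  label-comm x y = cong t (lca-comm x y)

  δ≡label : ∀ {x y} → x ≢ y → δ x y ≡ label x y
  δ≡label {x} {y} x≢y = sym (explains x y x≢y (lca x y) (lca-spec x y))

  lca-⊂⇒lca≡ : ∀ a b c → lca a b ⊂ lca a c → lca b c ≡ lca a c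
  lca-⊂⇒lca≡ a b c ab⊂ac = ⊆-antisym bc⊆ac ac⊆bc
    where
    c∉ab : c ∉ lca a b
    c∉ab c∈ab = ⊂-irref refl (⊂-⊆-trans ab⊂ac (lca-least a c _ (lca∈T a b) (x∈lca a b) c∈ab))
    bc⊆ac : lca b c ⊆ lca a c
    bc⊆ac = lca-least b c _ (lca∈T a c) (p⊂q⇒p⊆q ab⊂ac (y∈lca a b)) (y∈lca a c)
    ac⊆bc : lca a c ⊆ lca b c
    ac⊆bc with nested (lca∈T b c) (lca∈T a b) (x∈lca b c) (y∈lca a b)
    ... | inj₁ bc⊆ab = ⊥-elim (c∉ab (bc⊆ab (y∈lca b c)))
    ... | inj₂ ab⊆bc = lca-least a c _ (lca∈T b c) (ab⊆bc (x∈lca a b)) (y∈lca b c)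

  label≢⇒lca-⊂ : ∀ p q r → label p q ≢ label p r → label p q ≢ label q r → lca p q ⊂ lca p r
  label≢⇒lca-⊂ p q r pq≢pr pq≢qr
    with nested-trichotomy (lca∈T p q) (lca∈T p r) (x∈lca p q) (x∈lca p r)
  ... | inj₁ pq≡pr = ⊥-elim (pq≢pr (cong t pq≡pr))
  ... | inj₂ (inj₁ pq⊂pr) = pq⊂pr
  ... | inj₂ (inj₂ pr⊂pq) = ⊥-elim (pq≢qr (trans (sym (cong t (lca-⊂⇒lca≡ p r q pr⊂pq))) (label-comm r q)))

  symmetric : ∀ x y → x ≢ y → δ x y ≡ δ y x
  symmetric x y x≢y = trans (δ≡label x≢y) (trans (label-comm x y) (sym (δ≡label (x≢y ∘ sym))))

  at-most-two-labels : ∀ u v x → u ≢ v → u ≢ x → v ≢ x →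
    (δ u v ≡ δ u x) ⊎ (δ u v ≡ δ v x) ⊎ (δ u x ≡ δ v x)
  at-most-two-labels u v x u≢v u≢x v≢x
    with nested-trichotomy (lca∈T u v) (lca∈T u x) (x∈lca u v) (x∈lca u x)
  ... | inj₁ uv≡ux = inj₁ (trans (δ≡label u≢v) (trans (cong t uv≡ux) (sym (δ≡label u≢x))))
  ... | inj₂ (inj₁ uv⊂ux) = inj₂ (inj₂ (trans (δ≡label u≢x)
          (trans (cong t (sym (lca-⊂⇒lca≡ u v x uv⊂ux))) (sym (δ≡label v≢x)))))
  ... | inj₂ (inj₂ ux⊂uv) = inj₂ (inj₁ (trans (δ≡label u≢v)
          (trans (cong t (sym (lca-⊂⇒lca≡ u x v ux⊂uv))) (trans (label-comm x v) (sym (δ≡label v≢x))))))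

  no-forbidden-quartet : ∀ u v x y → u ≢ v → u ≢ x → u ≢ y → v ≢ x → v ≢ y → x ≢ y →
    ¬ ((δ x y ≡ δ y u) × (δ y u ≡ δ u v) × (δ u v ≢ δ y v) × (δ y v ≡ δ x v) × (δ x v ≡ δ x u))
  no-forbidden-quartet u v x y u≢v u≢x u≢y v≢x v≢y x≢y (xy≡yu , yu≡uv , a≢b , yv≡xv , xv≡xu) =
    ⊂-irref refl (⊂-trans (subst (lca y v ⊂_) (trans (lca-comm y u) (lca-⊂⇒lca≡ x u y xu⊂xy)) yv⊂yu)
                          (subst (lca x y ⊂_) (sym (lca-⊂⇒lca≡ x y v xy⊂xv)) xy⊂xv))
    where
    a = δ u v
    b = δ y v
    uv-a : label u v ≡ a
    uv-a = sym (δ≡label u≢v)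
    yu-a : label y u ≡ a
    yu-a = trans (sym (δ≡label (u≢y ∘ sym))) yu≡uv
    xy-a : label x y ≡ a
    xy-a = trans (sym (δ≡label x≢y)) (trans xy≡yu yu≡uv)
    yv-b : label y v ≡ b
    yv-b = sym (δ≡label (v≢y ∘ sym))
    xv-b : label x v ≡ b
    xv-b = trans (sym (δ≡label (v≢x ∘ sym))) (sym yv≡xv)
    xu-b : label x u ≡ b
    xu-b = trans (sym (δ≡label (u≢x ∘ sym))) (trans (sym xv≡xu) (sym yv≡xv))
    b≢a : ∀ {p q r s} → label p q ≡ b → label r s ≡ a → label p q ≢ label r s
    b≢a pq-b rs-a pq≡rs = a≢b (trans (sym rs-a) (trans (sym pq≡rs) pq-b))
    a≢b′ : ∀ {p q r s} → label p q ≡ a → label r s ≡ b → label p q ≢ label r s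
    a≢b′ pq-a rs-b pq≡rs = a≢b (trans (sym pq-a) (trans pq≡rs rs-b))
    yv⊂yu : lca y v ⊂ lca y u
    yv⊂yu = label≢⇒lca-⊂ y v u (b≢a yv-b yu-a) (b≢a yv-b (trans (label-comm v u) uv-a))
    xu⊂xy : lca x u ⊂ lca x y
    xu⊂xy = label≢⇒lca-⊂ x u y (b≢a xu-b xy-a) (b≢a xu-b (trans (label-comm u y) yu-a))
    xy⊂xv : lca x y ⊂ lca x v
    xy⊂xv = label≢⇒lca-⊂ x y v (a≢b′ xy-a xv-b) (a≢b′ xy-a yv-b)

  symbolicUltrametric : SymbolicUltrametric δ
  symbolicUltrametric = symmetric , no-forbidden-quartet , at-most-two-labels

indicator : Bool → ℕ
indicator b = if b then 1 else 0

indicator-mono : ∀ {a b} → (a ≡ true → b ≡ true) → indicator a ≤ indicator b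
indicator-mono {false} _ = z≤n
indicator-mono {true} a⇒b rewrite a⇒b refl = ℕ.≤-refl

clusterCount : ∀ {n} → Clusters n → ℕ
clusterCount {n} T = sum (map (indicator ∘ T) (allSubsets n))

clusterCount-contract : ∀ {n} (T : Clusters n) {B} → T B ≡ true → clusterCount (contract T B) < clusterCount T
clusterCount-contract {n} T {B} B∈T =
  sum-map-< (λ A → indicator-mono (proj₁ ∘ contract⁻ T B)) (∈-allSubsets B) B-counted-once
  where
  B-counted-once : indicator (contract T B B) < indicator (T B)
  B-counted-once rewrite contract-removes T B | B∈T = ℕ.≤-refl

module _ {n} {T : Clusters n} (isT : IsTree T) {A B : Subset n} (e : Edge T A B) where
  open Tree T isT

  IsLca-contract-≢ : ∀ {x y C} → IsLca T x y C → C ≢ B → IsLca (contract T B) x y C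
  IsLca-contract-≢ (C∈T , x∈C , y∈C , C-least) C≢B =
    contract⁺ T B C∈T C≢B , x∈C , y∈C , λ E E∈ x∈E y∈E → C-least E (proj₁ (contract⁻ T B E∈)) x∈E y∈E

  IsLca-contract-≡ : ∀ {x y} → IsLca T x y B → IsLca (contract T B) x y A
  IsLca-contract-≡ {x} {y} (_ , x∈B , y∈B , B-least) =
    contract⁺ T B (edge-upper∈ e) (⊂⇒≢ (edge-⊂ e) ∘ sym) , B⊆A x∈B , B⊆A y∈B , A-least
    where
    B⊆A = p⊂q⇒p⊆q (edge-⊂ e)
    A-least : ∀ E → contract T B E ≡ true → x ∈ E → y ∈ E → A ⊆ E
    A-least E E∈ x∈E y∈E with E∈T , E≢B ← contract⁻ T B E∈
      with nested-trichotomy E∈T (edge-upper∈ e) x∈E (B⊆A x∈B)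
    ... | inj₁ E≡A = ⊆-reflexive (sym E≡A)
    ... | inj₂ (inj₂ A⊂E) = p⊂q⇒p⊆q A⊂E
    ... | inj₂ (inj₁ E⊂A) = ⊥-elim (edge-tight e E E∈T (⊆∧≢⇒⊂ (B-least E E∈T x∈E y∈E) (E≢B ∘ sym)) E⊂A)

module Discriminating {n m} (δ : Fin n → Fin n → Fin m) (t : Subset n → Fin m) where

  contract-explainsV : ∀ {T A B} → IsTree T → Edge T A B → t A ≡ t B →
    ExplainsV T t δ → ExplainsV (contract T B) t δ
  contract-explainsV {T} {A} {B} isT e tA≡tB explains x y x≢y C lcaC with Tree.lca T isT x y ≟ˢ B
  ... | yes lca≡B = begin
      t C            ≡⟨ cong t (IsLca-unique lcaC (IsLca-contract-≡ isT e (subst (IsLca T x y) lca≡B (lca-spec x y)))) ⟩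
      t A            ≡⟨ tA≡tB ⟩
      t B            ≡⟨ explains x y x≢y B (subst (IsLca T x y) lca≡B (lca-spec x y)) ⟩
      δ x y          ∎
    where
    open ≡-Reasoning
    open Tree T isT
  ... | no lca≢B = trans (cong t (IsLca-unique lcaC (IsLca-contract-≢ isT e (lca-spec x y) lca≢B)))
                         (explains x y x≢y _ (lca-spec x y))
    where
    open Tree T isT

  BadEdge : Clusters n → Set
  BadEdge T = ∃[ A ] ∃[ B ] (Edge T A B × 2 ≤ ∣ B ∣ × t A ≡ t B)

  badEdge? : ∀ T → Dec (BadEdge T)
  badEdge? T = anySubset? λ A → anySubset? λ B →
    true? (isEdge T A B) ×-dec (2 ℕ.≤? ∣ B ∣) ×-dec (t A Fin.≟ t B)

  discriminate : ∀ T → IsTree T → ExplainsV T t δ → ∃ λ Tδ → IsTδ δ Tδ t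
  discriminate = measure-rec clusterCount Goal step
    where
    Goal : Clusters n → Set
    Goal T = IsTree T → ExplainsV T t δ → ∃ λ Tδ → IsTδ δ Tδ t
    step : ∀ T → (∀ T′ → clusterCount T′ < clusterCount T → Goal T′) → Goal T
    step T smaller isT explains with badEdge? T
    ... | no ∄ = T , isT , explains , λ A B e 2≤∣B∣ tA≡tB → ∄ (A , B , e , 2≤∣B∣ , tA≡tB)
    ... | yes (A , B , e , 2≤∣B∣ , tA≡tB) =
      smaller (contract T B) (clusterCount-contract T (EdgeOf.edge-lower∈ T e))
        (contract-isTree T B isT (Tree.edge-lower≢⊤ T isT e) 2≤∣B∣) (contract-explainsV isT e tA≡tB explains)

module Weight {n k : ℕ} (T : Clusters n) where

  edgeWeight : (Subset n → Subset n → Subset k) → Subset n → Subset n → ℕ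
  edgeWeight lam A B = if isEdge T A B then ∣ lam A B ∣ else 0

  weight≡double-sum : ∀ lam →
    weight T lam ≡ sum (map (λ A → sum (map (edgeWeight lam A) (allSubsets n))) (allSubsets n))
  weight≡double-sum lam = trans (sum-concat (map rows (allSubsets n))) (cong sum (sym (map-∘ (allSubsets n))))
    where
    rows : Subset n → List ℕ
    rows A = map (edgeWeight lam A) (allSubsets n)

  module _ {lam lam′ : Subset n → Subset n → Subset k}
           (≤-on-edges : ∀ A B → Edge T A B → ∣ lam A B ∣ ≤ ∣ lam′ A B ∣) where

    edgeWeight-mono : ∀ A B → edgeWeight lam A B ≤ edgeWeight lam′ A B
    edgeWeight-mono A B with isEdge T A B in e
    ... | true = ≤-on-edges A B e
    ... | false = z≤n

    weight-mono : weight T lam ≤ weight T lam′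
    weight-mono rewrite weight≡double-sum lam | weight≡double-sum lam′ =
      sum-map-mono (λ A → sum-map-mono (edgeWeight-mono A) (allSubsets n)) (allSubsets n)

    weight-< : ∀ {A B} → Edge T A B → ∣ lam A B ∣ < ∣ lam′ A B ∣ → weight T lam < weight T lam′
    weight-< {A} {B} e lam<lam′ rewrite weight≡double-sum lam | weight≡double-sum lam′ =
      sum-map-< (λ A → sum-map-mono (edgeWeight-mono A) (allSubsets n)) (∈-allSubsets A)
        (sum-map-< (edgeWeight-mono A) (∈-allSubsets B) edgeWeight-<)
      where
      edgeWeight-< : edgeWeight lam A B < edgeWeight lam′ A B
      edgeWeight-< rewrite e = lam<lam′

subclusters-isHierarchy : ∀ {n} {T H : Clusters n} → IsTree T → (∀ A → H A ≡ true → T A ≡ true) →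
  H ⊤ ≡ true → (∀ x → H ⁅ x ⁆ ≡ true) → IsHierarchy H
subclusters-isHierarchy ((_ , _ , laminar) , _) H⊆T ⊤∈H ⁅⁆∈H =
  ⊤∈H , ⁅⁆∈H , λ A B A∈H B∈H → laminar A B (H⊆T A A∈H) (H⊆T B B∈H)

module Main {n m k} (δ : Fin n → Fin n → Fin m) (ε : Fin n → Fin n → Subset k) where

  H* : Clusters n → Clusters n
  H* Tδ A = Tδ A ∨ Hε ε A

  Hε-⊥ : ∀ {T lam} → IsTree T → ExplainsE T lam ε → Hε ε ⊥ ≡ false
  Hε-⊥ {T} isT explains = false-if-¬true λ ⊥∈Hε →
    true≢false (Fitch.Hε⊆ ε T isT _ explains ⊥ ⊥∈Hε) (Tree.⊥∉ T isT)

  H*-isTree : ∀ {Tδ T lam} → IsTree Tδ → IsTree T → ExplainsE T lam ε →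
    IsHierarchy (H* Tδ) → IsTree (H* Tδ)
  H*-isTree {Tδ} isTδ isT explains hierarchy
    rewrite Tree.⊥∉ Tδ isTδ | Hε-⊥ isT explains = hierarchy , refl

  H*⊆ : ∀ {Tδ tδ T t lam} → IsTδ δ Tδ tδ → IsTree T → ExplainsV T t δ → ExplainsE T lam ε →
    ∀ A → H* Tδ A ≡ true → T A ≡ true
  H*⊆ {Tδ} {tδ} {T} {t} {lam} isTδ isT explainsV explainsE A A∈H* with ∨-true⁻ {Tδ A} A∈H*
  ... | inj₁ A∈Tδ = Refines.Tδ⊆T δ T isT t explainsV Tδ tδ isTδ A A∈Tδ
  ... | inj₂ A∈Hε = Fitch.Hε⊆ ε T isT lam explainsE A A∈Hε

  H*-isHierarchy : ∀ {Tδ tδ T t lam} → IsTδ δ Tδ tδ → IsTree T → ExplainsV T t δ → ExplainsE T lam ε →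
    IsHierarchy (H* Tδ)
  H*-isHierarchy {Tδ} isTδ isT explainsV explainsE =
    subclusters-isHierarchy isT (H*⊆ isTδ isT explainsV explainsE)
      (∨-trueˡ _ (Tree.⊤∈ Tδ (proj₁ isTδ))) (λ x → ∨-trueˡ _ (Tree.⁅⁆∈ Tδ (proj₁ isTδ) x))

  treeLike⇒ : TreeLike δ ε → SymbolicUltrametric δ × FitchMap ε ×
    (∃[ Tδ ] ∃[ tδ ] (IsTδ δ Tδ tδ × IsHierarchy (λ A → Tδ A ∨ Hε ε A)))
  treeLike⇒ (T , isT , t , lam , explainsV , explainsE)
    with Tδ , isTδ ← Discriminating.discriminate δ t T isT explainsV =
    Ultrametric.symbolicUltrametric δ T isT t explainsV , (T , lam , isT , explainsE) ,
    (Tδ , t , isTδ , H*-isHierarchy isTδ isT explainsV explainsE)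

  ⇒treeLike : SymbolicUltrametric δ × FitchMap ε ×
    (∃[ Tδ ] ∃[ tδ ] (IsTδ δ Tδ tδ × IsHierarchy (λ A → Tδ A ∨ Hε ε A))) → TreeLike δ ε
  ⇒treeLike (_ , (Tε , lamε , isTε , explainsTε) , (Tδ , tδ , (isTδ , explainsTδ , _) , hierarchy)) =
    H* Tδ , isT* , Refinement.explains δ ε Tδ tδ isTδ explainsTδ Tε isTε lamε explainsTε (H* Tδ) isT*
                     (λ A → ∨-trueˡ _) (λ A → ∨-trueʳ (Tδ A))
    where
    isT* : IsTree (H* Tδ)
    isT* = H*-isTree isTδ isTε explainsTε hierarchy

  module Optimal {T₀ t₀ lam₀} (isT₀ : IsTree T₀) (explainsV₀ : ExplainsV T₀ t₀ δ) (explainsE₀ : ExplainsE T₀ lam₀ ε)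
                 {Tδ tδ} (isTδ : IsTδ δ Tδ tδ) where

    T* : Clusters n
    T* = H* Tδ

    isT* : IsTree T*
    isT* = H*-isTree (proj₁ isTδ) isT₀ explainsE₀ (H*-isHierarchy isTδ isT₀ explainsV₀ explainsE₀)

    open Tree T* isT*

    refinement-explains : ∀ {T} → IsTree T → (∀ A → T* A ≡ true → T A ≡ true) → Explains T δ ε
    refinement-explains isT T*⊆T =
      Refinement.explains δ ε Tδ tδ (proj₁ isTδ) (proj₁ (proj₂ isTδ)) T₀ isT₀ lam₀ explainsE₀ _ isT
        (λ A A∈Tδ → T*⊆T A (∨-trueˡ _ A∈Tδ)) (λ A A∈Hε → T*⊆T A (∨-trueʳ (Tδ A) A∈Hε))

    explainsλε : ExplainsE T* (λ A B → λε ε B) ε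
    explainsλε = Refinement.explainsE δ ε Tδ tδ (proj₁ isTδ) (proj₁ (proj₂ isTδ)) T₀ isT₀ lam₀ explainsE₀
                   T* isT* (λ A → ∨-trueˡ _) (λ A → ∨-trueʳ (Tδ A))

    leastResolved : LeastResolved T* δ ε
    leastResolved = refinement-explains isT* (λ _ A∈ → A∈) , λ A B e 2≤∣B∣ (t , lam , explainsV , explainsE) →
      true≢false (H*⊆ isTδ (contract-isTree T* B isT* (edge-lower≢⊤ e) 2≤∣B∣) explainsV explainsE B (edge-lower∈ e))
                 (contract-removes T* B)

    leastResolved⇒⊆T* : ∀ {T} → IsTree T → LeastResolved T δ ε → ∀ A → T A ≡ true → T* A ≡ true
    leastResolved⇒⊆T* {T} isT ((_ , _ , explainsV , explainsE) , uncontractible) A A∈T =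
      decidable-stable (true? (T* A)) absurd
      where
      module T = Tree T isT
      absurd : ¬ T* A ≡ true → Empty
      absurd A∉T* with A ≟ˢ ⊤ | T.nonempty A∈T
      ... | yes refl | _ = A∉T* ⊤∈
      ... | no A≢⊤ | x , x∈A with ⁅⁆⊎2≤∣∣ x∈A | T.parent A∈T A≢⊤
      ...   | inj₁ refl | _ = A∉T* (⁅⁆∈ x)
      ...   | inj₂ 2≤∣A∣ | P , e = uncontractible P A e 2≤∣A∣
              (refinement-explains (contract-isTree T A isT A≢⊤ 2≤∣A∣)
                (λ C C∈T* → contract⁺ T A (H*⊆ isTδ isT explainsV explainsE C C∈T*) (λ { refl → A∉T* C∈T* })))

    leastResolved-unique : ∀ T → IsTree T → LeastResolved T δ ε → ∀ A → T A ≡ T* A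
    leastResolved-unique T isT lr@((_ , _ , explainsV , explainsE) , _) A =
      ≡-if-true⇔true (leastResolved⇒⊆T* isT lr A) (H*⊆ isTδ isT explainsV explainsE A)

    vertexLabel-unique : ∀ t lam → ExplainsV T* t δ → ExplainsE T* lam ε →
      ∀ A C → Inner T* A → MinAbove Tδ A C → t A ≡ tδ C
    vertexLabel-unique t lam explainsV _ A C (A∈T* , 2≤∣A∣) (C∈Tδ , A⊆C , C-least)
      with x , y , x≢y , lcaA@(_ , x∈A , y∈A , A-least) ← inner⇒IsLca A∈T* 2≤∣A∣ =
      trans (explainsV x y x≢y A lcaA) (sym (proj₁ (proj₂ isTδ) x y x≢y C
        (C∈Tδ , A⊆C x∈A , A⊆C y∈A , λ E E∈Tδ x∈E y∈E → C-least E E∈Tδ (A-least E (∨-trueˡ _ E∈Tδ) x∈E y∈E))))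

    labelledEdge-lower≡ : ∀ lam → ExplainsE T* lam ε → ∀ {A A′ B′ j y} → Edge T* A (Uneg ε j y) →
      Edge T* A′ B′ → y ∈ B′ → A′ ⊆ A → j ∈ lam A′ B′ → B′ ≡ Uneg ε j y
    labelledEdge-lower≡ lam explains {A} {A′} {B′} {j} {y} e e′ y∈B′ A′⊆A j∈
      with nested-trichotomy (edge-lower∈ e′) (edge-lower∈ e) y∈B′ (y∈Uneg ε)
    ... | inj₁ B′≡U = B′≡U
    ... | inj₂ (inj₂ U⊂B′) = ⊥-elim (edge-tight e B′ (edge-lower∈ e′) U⊂B′ (⊂-⊆-trans (edge-⊂ e′) A′⊆A))
    ... | inj₂ (inj₁ B′⊂U)
      with D , child@(_ , y∈D , (_ , x , x∈U , x∉D) , _) ← childToward (edge-lower∈ e) (⊆-⊂-trans (⁅⁆⊆ y∈B′) B′⊂U) =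
      ⊥-elim (∈ε⇒∉Uneg ε x≢y (Equivalence.from (explains x y x≢y _ lcaU j) (A′ , B′ , e′ , y∈B′ , A′⊆U , j∈)) x∈U)
      where
      x≢y : x ≢ y
      x≢y refl = x∉D y∈D
      lcaU : IsLca T* x y (Uneg ε j y)
      lcaU = IsLca-sym (childToward⇒IsLca (edge-lower∈ e) child x∈U x∉D)
      A′⊆U : A′ ⊆ Uneg ε j y
      A′⊆U with nested (edge-upper∈ e′) (edge-lower∈ e) (p⊂q⇒p⊆q (edge-⊂ e′) y∈B′) (y∈Uneg ε)
      ... | inj₁ A′⊆U = A′⊆U
      ... | inj₂ U⊆A′ with ⊆⇒≡⊎⊂ U⊆A′
      ...   | inj₁ U≡A′ = ⊆-reflexive (sym U≡A′)
      ...   | inj₂ U⊂A′ = ⊥-elim (edge-tight e′ _ (edge-lower∈ e) B′⊂U U⊂A′)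

    λε⊆label : ∀ lam → ExplainsE T* lam ε → ∀ {A B} → Edge T* A B → λε ε B ⊆ lam A B
    λε⊆label lam explains {A} {B} e {j} j∈λε with y , refl ← λε⁻ ε {B} j∈λε
      with _ , x , x∈A , x∉U ← edge-⊂ e
      with A′ , B′ , e′ , y∈B′ , A′⊆A , j∈′ ←
             Equivalence.to (explains x y (λ { refl → x∉U (y∈Uneg ε) }) A
               (IsLca-sym (edge⇒IsLca e (y∈Uneg ε) x∈A x∉U)) j) (∉Uneg⇒∈ε ε x∉U)
      with refl ← labelledEdge-lower≡ lam explains e e′ y∈B′ A′⊆A j∈′
      with refl ← parent-unique e e′ = j∈′

    λε-weight-minimal : ∀ lam → ExplainsE T* lam ε →
      (weight T* (λ A B → λε ε B) ≤ weight T* lam)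
      × (weight T* lam ≡ weight T* (λ A B → λε ε B) → ∀ A B → Edge T* A B → lam A B ≡ λε ε B)
    λε-weight-minimal lam explains = Weight.weight-mono T* {λ A B → λε ε B} {lam} ∣λε∣≤∣lam∣ , equality
      where
      ∣λε∣≤∣lam∣ : ∀ A B → Edge T* A B → ∣ λε ε B ∣ ≤ ∣ lam A B ∣
      ∣λε∣≤∣lam∣ A B e = p⊆q⇒∣p∣≤∣q∣ (λε⊆label lam explains e)
      equality : weight T* lam ≡ weight T* (λ A B → λε ε B) → ∀ A B → Edge T* A B → lam A B ≡ λε ε B
      equality same A B e with λε ε B ≟ˢ lam A B
      ... | yes λε≡lam = sym λε≡lam
      ... | no λε≢lam = ⊥-elim (ℕ.<-irrefl (sym same)
            (Weight.weight-< T* {λ A B → λε ε B} {lam} ∣λε∣≤∣lam∣ e (p⊂q⇒∣p∣<∣q∣ (⊆∧≢⇒⊂ (λε⊆label lam explains e) λε≢lam))))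

theorem1 : ∀ {n m k : ℕ} (δ : Fin n → Fin n → Fin m) (ε : Fin n → Fin n → Subset k) →
    (TreeLike δ ε ⇔
      (SymbolicUltrametric δ × FitchMap ε ×
        (∃[ Tδ ] ∃[ tδ ] (IsTδ δ Tδ tδ × IsHierarchy (λ A → Tδ A ∨ Hε ε A)))))
    × (TreeLike δ ε → ∀ Tδ tδ → IsTδ δ Tδ tδ →
        Σ[ T* ∈ Clusters n ]
          ((∀ A → T* A ≡ (Tδ A ∨ Hε ε A))
          × IsTree T*
          × LeastResolved T* δ ε
          × (∀ T → IsTree T → LeastResolved T δ ε → ∀ A → T A ≡ T* A)
          × (∀ t lam → ExplainsV T* t δ → ExplainsE T* lam ε →
               ∀ A C → Inner T* A → MinAbove Tδ A C → t A ≡ tδ C)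
          × ExplainsE T* (λ A B → λε ε B) ε
          × (∀ lam → ExplainsE T* lam ε →
               (weight T* (λ A B → λε ε B) ≤ weight T* lam)
               × (weight T* lam ≡ weight T* (λ A B → λε ε B) →
                    ∀ A B → Edge T* A B → lam A B ≡ λε ε B))))
theorem1 δ ε = mk⇔ treeLike⇒ ⇒treeLike ,
  λ (_ , isT₀ , _ , _ , explainsV₀ , explainsE₀) _ _ isTδ →
    let open Optimal isT₀ explainsV₀ explainsE₀ isTδ
    in T* , (λ _ → refl) , isT* , leastResolved , leastResolved-unique , vertexLabel-unique ,
       explainsλε , λε-weight-minimal
  where
  open Main δ ε
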